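{- Let $A$ be an $n$-by-$n$ reciprocal matrix that is not consistent, and let $\mathcal{C}$ be a Hamiltonian cycle with cycle product in $A$ at most $1$. Then there is a $w\in\varepsilon_A(\mathcal{C})$ that exhibits no order reversal at any pair $i,j$ with $i\to j$ an edge of $\mathcal{C}$ if and only if either some entry of $A$ along $\mathcal{C}$ is $>1$ or the cycle product of $\mathcal{C}$ in $A$ equals $1$. Otherwise, there is a $w\in\varepsilon_A(\mathcal{C})$ exhibiting an order reversal at exactly one pair $i,j$ with $i\to j$ an edge of $\mathcal{C}$.
   Context: An $n$-by-$n$ matrix $A=[a_{ij}]$ is reciprocal if all its entries are positive and $a_{ji}=1/a_{ij}$; it is consistent if $A=[w_i/w_j]$ for some positive $w$. For a Hamiltonian cycle $\mathcal{C}:\gamma_1\to\cdots\to\gamma_n\to\gamma_1$, the entries of $A$ along $\mathcal{C}$ are $a_{\gamma_1\gamma_2},\dots,a_{\gamma_{n-1}\gamma_n},a_{\gamma_n\gamma_1}$ and its cycle product is their product. $G(A,w)$ is the digraph on $\{1,\dots,n\}$ with an edge $i\to j$ ($i\ne j$) iff $w_i\ge a_{ij}w_j$; $\varepsilon_A(\mathcal{C})$ is the set of positive $w$ such that $G(A,w)$ contains $\mathcal{C}$. A positive vector $w$ exhibits an order reversal at $i,j$ if $w_i>w_j$ when $a_{ij}<1$, or $w_i<w_j$ when $a_{ij}>1$, or $w_i=w_j$ when $a_{ij}\ne 1$, or $w_i\ne w_j$ when $a_{ij}=1$. -}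

module Defs where

open import Level using (0ℓ)
open import Data.Nat as ℕ using (ℕ; zero; suc; NonZero)
open import Data.Nat.DivMod using (_%_; m%n<n)
open import Data.Fin using (Fin; toℕ; fromℕ<) renaming (zero to fzero; suc to fsuc)
open import Data.Product using (Σ; _×_; ∃; ∃-syntax)
import Data.Product
open import Data.Sum using (_⊎_)
open import Data.Empty using (⊥)
open import Relation.Nullary using (¬_)
open import Relation.Binary.PropositionalEquality using (_≡_)
import Algebra.Structures as AS

-- The real numbers, axiomatised as a complete ordered field
-- (unique up to isomorphism; this is how ℝ enters the statement).

record RealField : Set₁ where
  infixl 7 _*_
  infixl 6 _+_
  infix  4 _<_ _≤_
  field
    ℝ     : Set
    _+_   : ℝ → ℝ → ℝ
    _*_   : ℝ → ℝ → ℝ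
    -_    : ℝ → ℝ
    0# 1# : ℝ
    _⁻¹   : ℝ → ℝ
    _<_   : ℝ → ℝ → Set
    isCommutativeRing : AS.IsCommutativeRing (_≡_ {A = ℝ}) _+_ _*_ -_ 0# 1#
    0≢1      : ¬ (0# ≡ 1#)
    ⁻¹-inverse : ∀ x → ¬ (x ≡ 0#) → x * (x ⁻¹) ≡ 1#
    <-irrefl : ∀ x → ¬ (x < x)
    <-trans  : ∀ {x y z} → x < y → y < z → x < z
    <-trichotomy : ∀ x y → x < y ⊎ (x ≡ y ⊎ y < x)
    +-mono-< : ∀ {x y} z → x < y → x + z < y + z
    *-pos    : ∀ {x y} → 0# < x → 0# < y → 0# < x * y

  _≤_ : ℝ → ℝ → Set
  x ≤ y = x < y ⊎ x ≡ y

  UpperBound : (ℝ → Set) → ℝ → Set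
  UpperBound P b = ∀ x → P x → x ≤ b

  field
    sup : (P : ℝ → Set) → (∃ λ x → P x) → (∃ λ b → UpperBound P b) →
          Σ ℝ λ s → UpperBound P s × (∀ b → UpperBound P b → s ≤ b)

module Matrices (R : RealField) where
  open RealField R

  Matrix : ℕ → Set
  Matrix n = Fin n → Fin n → ℝ

  Positive : ∀ {n} → (Fin n → ℝ) → Set
  Positive w = ∀ i → 0# < w i

  Reciprocal : ∀ {n} → Matrix n → Set
  Reciprocal A = (∀ i j → 0# < A i j) × (∀ i j → A j i * A i j ≡ 1#)

  Consistent : ∀ {n} → Matrix n → Set
  Consistent {n} A = Σ (Fin n → ℝ) λ w → Positive w × (∀ i j → A i j * w j ≡ w i)

  prodFin : ∀ {n} → (Fin n → ℝ) → ℝ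
  prodFin {zero}  f = 1#
  prodFin {suc n} f = f fzero * prodFin (λ k → f (fsuc k))

  next : ∀ {n} .{{_ : NonZero n}} → Fin n → Fin n
  next {n} k = fromℕ< (m%n<n (suc (toℕ k)) n)

  -- A Hamiltonian cycle γ_1 → … → γ_n → γ_1 is given by an injective
  -- (hence bijective) enumeration γ : Fin n → Fin n of the vertices.
  HamiltonianCycle : ℕ → Set
  HamiltonianCycle n = Σ (Fin n → Fin n) λ γ → ∀ i j → γ i ≡ γ j → i ≡ j

  module _ {n} .{{_ : NonZero n}} (A : Matrix n) (C : HamiltonianCycle n) where
    private
      γ : Fin n → Fin n
      γ = Data.Product.proj₁ C

    entryAlong : Fin n → ℝ
    entryAlong k = A (γ k) (γ (next k))

    cycleProduct : ℝ
    cycleProduct = prodFin entryAlong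

    -- ε_A(C): positive w such that G(A,w) contains every edge γ_k → γ_{k+1},
    -- i.e. w_{γ_k} ≥ a_{γ_k γ_{k+1}} w_{γ_{k+1}}
    InEpsilon : (Fin n → ℝ) → Set
    InEpsilon w = Positive w × (∀ k → A (γ k) (γ (next k)) * w (γ (next k)) ≤ w (γ k))

  OrderReversal : ∀ {n} → Matrix n → (Fin n → ℝ) → Fin n → Fin n → Set
  OrderReversal A w i j =
      (A i j < 1# × w j < w i)
    ⊎ (1# < A i j × w i < w j)
    ⊎ (¬ (A i j ≡ 1#) × w i ≡ w j)
    ⊎ (A i j ≡ 1# × ¬ (w i ≡ w j))

-- Write c_k for the entries of A along C and P for their product (P ≤ 1).  If no edge of C is an
-- order reversal and no c_k exceeds 1, the weights w_{γ_k} cannot decrease along the cycle, so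
-- they are all equal, which forces every c_k = 1 and P = 1.  Conversely, cutting the cycle at
-- an edge m, the entries c_k with the one at m divided by P multiply to 1, so they admit exact
-- weights w_{γ_k} = c_k w_{γ_{k+1}}; at m this becomes c_m w_{γ_{m+1}} = P w_{γ_m} ≤ w_{γ_m}.
-- Such w lies in ε_A(C) and is reversal-free off m.  At m there is no reversal when c_m > 1 or
-- P = 1; if neither condition holds, cutting at an entry c_m < 1 leaves exactly one reversal.
module Submission where

open import Defs
open import Level using (0ℓ)
open import Data.Nat using (ℕ; NonZero; zero; suc; s<s; _%_)
open import Data.Nat.Properties using (1+n≰n)
open import Data.Nat.DivMod using (m<n⇒m%n≡m; n%n≡0)
open import Data.Fin using (Fin; toℕ; inject₁; fromℕ; punchOut; _≟_) renaming (zero to fzero; suc to fsuc)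
open import Data.Fin.Properties using (toℕ-injective; toℕ-fromℕ<; toℕ-inject₁; toℕ-fromℕ; inject₁ℕ<; any?; punchOut-injective; injective⇒≤)
open import Data.Fin.Relation.Unary.Top using (view; ‵fromℕ; ‵inject₁)
open import Data.Product using (Σ; _×_; proj₁; proj₂; _,_; ∃)
open import Data.Sum using (_⊎_; inj₁; inj₂)
open import Function using (_∘_)
open import Function.Bundles using (_⇔_; mk⇔; Equivalence)
open import Function.Definitions using (Injective)
open import Relation.Nullary using (¬_; yes; no; contradiction)
open import Relation.Binary.Definitions using (Decidable)
open import Relation.Binary.PropositionalEquality using (_≡_; _≢_; refl; sym; trans; cong; cong₂; subst; subst₂; module ≡-Reasoning)
open import Algebra.Bundles using (CommutativeRing)
import Algebra.Properties.Ring as RingProperties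

open ≡-Reasoning

injective⇒surjective : ∀ {n} {f : Fin n → Fin n} → Injective _≡_ _≡_ f → ∀ j → ∃ λ i → f i ≡ j
injective⇒surjective {suc n} {f} f-injective j with any? (λ i → f i ≟ j)
... | yes hit = hit
... | no miss = contradiction (injective⇒≤ skip-injective) 1+n≰n
  where
  j≢f : ∀ i → j ≢ f i
  j≢f i j≡fi = miss (i , sym j≡fi)

  skip : Fin (suc n) → Fin n
  skip i = punchOut (j≢f i)

  skip-injective : Injective _≡_ _≡_ skip
  skip-injective {x} {y} eq = f-injective (punchOut-injective (j≢f x) (j≢f y) eq)

module _ (R : RealField) where
  open RealField R
  open Matrices R

  next-inject₁ : ∀ {n} (k : Fin n) → next (inject₁ k) ≡ fsuc k
  next-inject₁ {n} k = toℕ-injective (begin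
    toℕ (next (inject₁ k))        ≡⟨ toℕ-fromℕ< _ ⟩
    suc (toℕ (inject₁ k)) % suc n ≡⟨ m<n⇒m%n≡m (s<s (inject₁ℕ< k)) ⟩
    suc (toℕ (inject₁ k))         ≡⟨ cong suc (toℕ-inject₁ k) ⟩
    suc (toℕ k)                   ∎)

  next-fromℕ : ∀ n → next (fromℕ n) ≡ fzero
  next-fromℕ n = toℕ-injective (begin
    toℕ (next (fromℕ n))        ≡⟨ toℕ-fromℕ< _ ⟩
    suc (toℕ (fromℕ n)) % suc n ≡⟨ cong (λ t → suc t % suc n) (toℕ-fromℕ n) ⟩
    suc n % suc n               ≡⟨ n%n≡0 (suc n) ⟩
    0                           ∎)

  private
    ring : CommutativeRing 0ℓ 0ℓ
    ring = record { isCommutativeRing = isCommutativeRing }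

  open CommutativeRing ring using (_-_; +-assoc; *-assoc; *-comm; zeroˡ; -‿inverseˡ; -‿inverseʳ; +-identityˡ; +-identityʳ; *-identityˡ)
  open RingProperties (CommutativeRing.ring ring) using (-‿distribˡ-*; -‿involutive; [y-z]x≈yx-zx)

  <-asym : ∀ {x y} → x < y → ¬ (y < x)
  <-asym x<y y<x = <-irrefl _ (<-trans x<y y<x)

  <⇒≢ : ∀ {x y} → x < y → x ≢ y
  <⇒≢ x<y refl = <-irrefl _ x<y

  ≤-trans : ∀ {x y z} → x ≤ y → y ≤ z → x ≤ z
  ≤-trans (inj₁ x<y) (inj₁ y<z)  = inj₁ (<-trans x<y y<z)
  ≤-trans (inj₁ x<y) (inj₂ refl) = inj₁ x<y
  ≤-trans (inj₂ refl) y≤z        = y≤z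

  <-≤-trans : ∀ {x y z} → x < y → y ≤ z → x < z
  <-≤-trans x<y (inj₁ y<z)  = <-trans x<y y<z
  <-≤-trans x<y (inj₂ refl) = x<y

  ≤-antisym : ∀ {x y} → x ≤ y → y ≤ x → x ≡ y
  ≤-antisym (inj₂ x≡y)  _           = x≡y
  ≤-antisym (inj₁ x<y) (inj₂ y≡x)  = sym y≡x
  ≤-antisym (inj₁ x<y) (inj₁ y<x)  = contradiction y<x (<-asym x<y)

  <⇒≱ : ∀ {x y} → x < y → ¬ (y ≤ x)
  <⇒≱ x<y (inj₁ y<x)  = <-asym x<y y<x
  <⇒≱ x<y (inj₂ refl) = <-irrefl _ x<y

  ≤⊎> : ∀ x y → x ≤ y ⊎ y < x
  ≤⊎> x y with <-trichotomy x y
  ... | inj₁ x<y        = inj₁ (inj₁ x<y)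
  ... | inj₂ (inj₁ x≡y) = inj₁ (inj₂ x≡y)
  ... | inj₂ (inj₂ y<x) = inj₂ y<x

  _<?_ : Decidable _<_
  x <? y with <-trichotomy x y
  ... | inj₁ x<y        = yes x<y
  ... | inj₂ (inj₁ x≡y) = no λ x<y → <⇒≢ x<y x≡y
  ... | inj₂ (inj₂ y<x) = no (<-asym y<x)

  ≮∧≯⇒≡ : ∀ {x y} → ¬ (x < y) → ¬ (y < x) → x ≡ y
  ≮∧≯⇒≡ {x} {y} x≮y y≮x with <-trichotomy x y
  ... | inj₁ x<y        = contradiction x<y x≮y
  ... | inj₂ (inj₁ x≡y) = x≡y
  ... | inj₂ (inj₂ y<x) = contradiction y<x y≮x

  *-monoˡ-< : ∀ {x y z} → 0# < z → x < y → x * z < y * z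
  *-monoˡ-< {x} {y} {z} 0<z x<y = subst₂ _<_ (+-identityˡ (x * z)) yz-xz+xz≡yz
    (+-mono-< (x * z) (*-pos 0<y-x 0<z))
    where
    0<y-x : 0# < y - x
    0<y-x = subst (_< y - x) (-‿inverseʳ x) (+-mono-< (- x) x<y)

    yz-xz+xz≡yz : (y - x) * z + x * z ≡ y * z
    yz-xz+xz≡yz = begin
      (y - x) * z + x * z         ≡⟨ cong (_+ x * z) ([y-z]x≈yx-zx z y x) ⟩
      (y * z - x * z) + x * z     ≡⟨ +-assoc (y * z) (- (x * z)) (x * z) ⟩
      y * z + (- (x * z) + x * z) ≡⟨ cong (y * z +_) (-‿inverseˡ (x * z)) ⟩
      y * z + 0#                  ≡⟨ +-identityʳ (y * z) ⟩
      y * z                       ∎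

  *-monoˡ-≤ : ∀ {x y z} → 0# < z → x ≤ y → x * z ≤ y * z
  *-monoˡ-≤ 0<z (inj₁ x<y)  = inj₁ (*-monoˡ-< 0<z x<y)
  *-monoˡ-≤ 0<z (inj₂ refl) = inj₂ refl

  x<1⇒x*y<y : ∀ {x y} → 0# < y → x < 1# → x * y < y
  x<1⇒x*y<y {x} {y} 0<y x<1 = subst (x * y <_) (*-identityˡ y) (*-monoˡ-< 0<y x<1)

  1<x⇒y<x*y : ∀ {x y} → 0# < y → 1# < x → y < x * y
  1<x⇒y<x*y {x} {y} 0<y 1<x = subst (_< x * y) (*-identityˡ y) (*-monoˡ-< 0<y 1<x)

  0<1 : 0# < 1#
  0<1 with <-trichotomy 0# 1#
  ... | inj₁ 0<1        = 0<1
  ... | inj₂ (inj₁ 0≡1) = contradiction 0≡1 0≢1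
  ... | inj₂ (inj₂ 1<0) = contradiction (subst (0# <_) -1*-1≡1 (*-pos 0<-1 0<-1)) (<-asym 1<0)
    where
    0<-1 : 0# < - 1#
    0<-1 = subst₂ _<_ (-‿inverseʳ 1#) (+-identityˡ (- 1#)) (+-mono-< (- 1#) 1<0)

    -1*-1≡1 : - 1# * - 1# ≡ 1#
    -1*-1≡1 = begin
      - 1# * - 1#     ≡⟨ -‿distribˡ-* 1# (- 1#) ⟨
      - (1# * - 1#)   ≡⟨ cong -_ (*-identityˡ (- 1#)) ⟩
      - - 1#          ≡⟨ -‿involutive 1# ⟩
      1#              ∎

  x⁻¹*x≡1 : ∀ {x} → 0# < x → x ⁻¹ * x ≡ 1#
  x⁻¹*x≡1 {x} 0<x = trans (*-comm (x ⁻¹) x) (⁻¹-inverse x (<⇒≢ 0<x ∘ sym))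

  ⁻¹-pos : ∀ {x} → 0# < x → 0# < x ⁻¹
  ⁻¹-pos {x} 0<x with <-trichotomy 0# (x ⁻¹)
  ... | inj₁ 0<x⁻¹        = 0<x⁻¹
  ... | inj₂ (inj₁ 0≡x⁻¹) = contradiction (trans (sym (zeroˡ x)) (trans (cong (_* x) 0≡x⁻¹) (x⁻¹*x≡1 0<x))) 0≢1
  ... | inj₂ (inj₂ x⁻¹<0) = contradiction (subst₂ _<_ (x⁻¹*x≡1 0<x) (zeroˡ x) (*-monoˡ-< 0<x x⁻¹<0)) (<-asym 0<1)

  prodFin-pos : ∀ {n} (f : Fin n → ℝ) → (∀ k → 0# < f k) → 0# < prodFin f
  prodFin-pos {zero}  f f-pos = 0<1
  prodFin-pos {suc n} f f-pos = *-pos (f-pos fzero) (prodFin-pos (f ∘ fsuc) (f-pos ∘ fsuc))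

  prodFin-≡1 : ∀ {n} (f : Fin n → ℝ) → (∀ k → f k ≡ 1#) → prodFin f ≡ 1#
  prodFin-≡1 {zero}  f f≡1 = refl
  prodFin-≡1 {suc n} f f≡1 =
    trans (cong₂ _*_ (f≡1 fzero) (prodFin-≡1 (f ∘ fsuc) (f≡1 ∘ fsuc))) (*-identityˡ 1#)

  tailProd : ∀ {n} → (Fin n → ℝ) → Fin n → ℝ
  tailProd f fzero    = prodFin f
  tailProd f (fsuc k) = tailProd (f ∘ fsuc) k

  tailProd-inject₁ : ∀ {n} (f : Fin (suc n) → ℝ) (k : Fin n) →
                     tailProd f (inject₁ k) ≡ f (inject₁ k) * tailProd f (fsuc k)
  tailProd-inject₁ f fzero    = refl
  tailProd-inject₁ f (fsuc k) = tailProd-inject₁ (f ∘ fsuc) k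

  tailProd-fromℕ : ∀ {n} (f : Fin (suc n) → ℝ) → tailProd f (fromℕ n) ≡ f (fromℕ n) * 1#
  tailProd-fromℕ {zero}  f = refl
  tailProd-fromℕ {suc n} f = tailProd-fromℕ (f ∘ fsuc)

  tailProd-pos : ∀ {n} (f : Fin n → ℝ) → (∀ k → 0# < f k) → ∀ k → 0# < tailProd f k
  tailProd-pos f f-pos fzero    = prodFin-pos f f-pos
  tailProd-pos f f-pos (fsuc k) = tailProd-pos (f ∘ fsuc) (f-pos ∘ fsuc) k

  tailProd-exact : ∀ {n} (f : Fin (suc n) → ℝ) → prodFin f ≡ 1# →
                   ∀ k → tailProd f k ≡ f k * tailProd f (next k)
  tailProd-exact {n} f ∏f≡1 k with view k
  ... | ‵fromℕ = begin
    tailProd f (fromℕ n)                 ≡⟨ tailProd-fromℕ f ⟩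
    f (fromℕ n) * 1#                     ≡⟨ cong (f (fromℕ n) *_) ∏f≡1 ⟨
    f (fromℕ n) * tailProd f fzero       ≡⟨ cong (λ i → f (fromℕ n) * tailProd f i) (next-fromℕ n) ⟨
    f (fromℕ n) * tailProd f (next (fromℕ n)) ∎
  ... | ‵inject₁ j = begin
    tailProd f (inject₁ j)               ≡⟨ tailProd-inject₁ f j ⟩
    f (inject₁ j) * tailProd f (fsuc j)  ≡⟨ cong (λ i → f (inject₁ j) * tailProd f i) (next-inject₁ j) ⟨
    f (inject₁ j) * tailProd f (next (inject₁ j)) ∎

  scaleAt : ∀ {n} → Fin n → ℝ → (Fin n → ℝ) → Fin n → ℝ
  scaleAt fzero    s f fzero    = f fzero * s
  scaleAt fzero    s f (fsuc k) = f (fsuc k)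
  scaleAt (fsuc m) s f fzero    = f fzero
  scaleAt (fsuc m) s f (fsuc k) = scaleAt m s (f ∘ fsuc) k

  scaleAt-self : ∀ {n} (m : Fin n) s f → scaleAt m s f m ≡ f m * s
  scaleAt-self fzero    s f = refl
  scaleAt-self (fsuc m) s f = scaleAt-self m s (f ∘ fsuc)

  scaleAt-≢ : ∀ {n} {m k : Fin n} s f → k ≢ m → scaleAt m s f k ≡ f k
  scaleAt-≢ {m = fzero}  {fzero}  s f k≢m = contradiction refl k≢m
  scaleAt-≢ {m = fzero}  {fsuc k} s f k≢m = refl
  scaleAt-≢ {m = fsuc m} {fzero}  s f k≢m = refl
  scaleAt-≢ {m = fsuc m} {fsuc k} s f k≢m = scaleAt-≢ s (f ∘ fsuc) (k≢m ∘ cong fsuc)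

  prodFin-scaleAt : ∀ {n} (m : Fin n) s f → prodFin (scaleAt m s f) ≡ prodFin f * s
  prodFin-scaleAt {suc n} fzero s f = begin
    f fzero * s * prodFin (f ∘ fsuc)   ≡⟨ *-assoc (f fzero) s _ ⟩
    f fzero * (s * prodFin (f ∘ fsuc)) ≡⟨ cong (f fzero *_) (*-comm s _) ⟩
    f fzero * (prodFin (f ∘ fsuc) * s) ≡⟨ *-assoc (f fzero) _ s ⟨
    f fzero * prodFin (f ∘ fsuc) * s   ∎
  prodFin-scaleAt {suc n} (fsuc m) s f = begin
    f fzero * prodFin (scaleAt m s (f ∘ fsuc)) ≡⟨ cong (f fzero *_) (prodFin-scaleAt m s (f ∘ fsuc)) ⟩
    f fzero * (prodFin (f ∘ fsuc) * s)         ≡⟨ *-assoc (f fzero) _ s ⟨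
    f fzero * prodFin (f ∘ fsuc) * s           ∎

  module CutWeights {n} (c : Fin (suc n) → ℝ) (c-pos : ∀ k → 0# < c k) (m : Fin (suc n)) where
    private
      P : ℝ
      P = prodFin c

      0<P : 0# < P
      0<P = prodFin-pos c c-pos

      c′ : Fin (suc n) → ℝ
      c′ = scaleAt m (P ⁻¹) c

      c′-pos : ∀ k → 0# < c′ k
      c′-pos k with k ≟ m
      ... | yes refl = subst (0# <_) (sym (scaleAt-self m (P ⁻¹) c)) (*-pos (c-pos m) (⁻¹-pos 0<P))
      ... | no k≢m   = subst (0# <_) (sym (scaleAt-≢ (P ⁻¹) c k≢m)) (c-pos k)

      P*P⁻¹≡1 : P * P ⁻¹ ≡ 1#
      P*P⁻¹≡1 = ⁻¹-inverse P (<⇒≢ 0<P ∘ sym)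

      ∏c′≡1 : prodFin c′ ≡ 1#
      ∏c′≡1 = trans (prodFin-scaleAt m (P ⁻¹) c) P*P⁻¹≡1

    weights : Fin (suc n) → ℝ
    weights = tailProd c′

    weights-pos : ∀ k → 0# < weights k
    weights-pos = tailProd-pos c′ c′-pos

    weights-exact : ∀ k → k ≢ m → weights k ≡ c k * weights (next k)
    weights-exact k k≢m =
      trans (tailProd-exact c′ ∏c′≡1 k) (cong (_* weights (next k)) (scaleAt-≢ (P ⁻¹) c k≢m))

    weights-cut : c m * weights (next m) ≡ P * weights m
    weights-cut = begin
      c m * v                   ≡⟨ *-identityˡ (c m * v) ⟨
      1# * (c m * v)            ≡⟨ cong (_* (c m * v)) P*P⁻¹≡1 ⟨
      P * P ⁻¹ * (c m * v)      ≡⟨ *-assoc P (P ⁻¹) (c m * v) ⟩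
      P * (P ⁻¹ * (c m * v))    ≡⟨ cong (P *_) (*-assoc (P ⁻¹) (c m) v) ⟨
      P * (P ⁻¹ * c m * v)      ≡⟨ cong (λ x → P * (x * v)) (*-comm (P ⁻¹) (c m)) ⟩
      P * (c m * P ⁻¹ * v)      ≡⟨ cong (λ x → P * (x * v)) (scaleAt-self m (P ⁻¹) c) ⟨
      P * (c′ m * v)            ≡⟨ cong (P *_) (tailProd-exact c′ ∏c′≡1 m) ⟨
      P * weights m             ∎
      where
      v : ℝ
      v = weights (next m)

  Ascending : ∀ {n} → (Fin (suc n) → ℝ) → Set
  Ascending u = ∀ k → u (inject₁ k) ≤ u (fsuc k)

  ascending⇒zero≤ : ∀ {n} (u : Fin (suc n) → ℝ) → Ascending u → ∀ k → u fzero ≤ u k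
  ascending⇒zero≤         u u↑ fzero    = inj₂ refl
  ascending⇒zero≤ {suc n} u u↑ (fsuc k) = ≤-trans (u↑ fzero) (ascending⇒zero≤ (u ∘ fsuc) (u↑ ∘ fsuc) k)

  ascending⇒≤fromℕ : ∀ {n} (u : Fin (suc n) → ℝ) → Ascending u → ∀ k → u k ≤ u (fromℕ n)
  ascending⇒≤fromℕ {zero}  u u↑ fzero    = inj₂ refl
  ascending⇒≤fromℕ {suc n} u u↑ fzero    = ≤-trans (u↑ fzero) (ascending⇒≤fromℕ (u ∘ fsuc) (u↑ ∘ fsuc) fzero)
  ascending⇒≤fromℕ {suc n} u u↑ (fsuc k) = ascending⇒≤fromℕ (u ∘ fsuc) (u↑ ∘ fsuc) k

  cyclic-ascending⇒constant : ∀ {n} (u : Fin (suc n) → ℝ) → (∀ k → u k ≤ u (next k)) → ∀ k → u k ≡ u fzero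
  cyclic-ascending⇒constant {n} u u↑ k =
    ≤-antisym (≤-trans (ascending⇒≤fromℕ u ascending k) wrap) (ascending⇒zero≤ u ascending k)
    where
    ascending : Ascending u
    ascending k = subst (λ i → u (inject₁ k) ≤ u i) (next-inject₁ k) (u↑ (inject₁ k))

    wrap : u (fromℕ n) ≤ u fzero
    wrap = subst (λ i → u (fromℕ n) ≤ u i) (next-fromℕ n) (u↑ (fromℕ n))

  module _ {n} (A : Matrix n) (w : Fin n → ℝ) {i j : Fin n} where

    tight⇒¬OrderReversal : 0# < w j → w i ≡ A i j * w j → ¬ OrderReversal A w i j
    tight⇒¬OrderReversal 0<wj tight (inj₁ (a<1 , wj<wi)) =
      <-asym wj<wi (subst (_< w j) (sym tight) (x<1⇒x*y<y 0<wj a<1))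
    tight⇒¬OrderReversal 0<wj tight (inj₂ (inj₁ (1<a , wi<wj))) =
      <-asym wi<wj (subst (w j <_) (sym tight) (1<x⇒y<x*y 0<wj 1<a))
    tight⇒¬OrderReversal 0<wj tight (inj₂ (inj₂ (inj₁ (a≢1 , wi≡wj)))) = a≢1 (≮∧≯⇒≡
      (λ a<1 → <⇒≢ (x<1⇒x*y<y 0<wj a<1) a*wj≡wj)
      (λ 1<a → <⇒≢ (1<x⇒y<x*y 0<wj 1<a) (sym a*wj≡wj)))
      where
      a*wj≡wj : A i j * w j ≡ w j
      a*wj≡wj = trans (sym tight) wi≡wj
    tight⇒¬OrderReversal 0<wj tight (inj₂ (inj₂ (inj₂ (a≡1 , wi≢wj)))) =
      wi≢wj (trans tight (trans (cong (_* w j) a≡1) (*-identityˡ (w j))))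

    1<entry⇒¬OrderReversal : 0# < w j → 1# < A i j → A i j * w j ≤ w i → ¬ OrderReversal A w i j
    1<entry⇒¬OrderReversal 0<wj 1<a a*wj≤wi (inj₁ (a<1 , _)) = <-asym a<1 1<a
    1<entry⇒¬OrderReversal 0<wj 1<a a*wj≤wi (inj₂ (inj₁ (_ , wi<wj))) =
      <-asym wi<wj (<-≤-trans (1<x⇒y<x*y 0<wj 1<a) a*wj≤wi)
    1<entry⇒¬OrderReversal 0<wj 1<a a*wj≤wi (inj₂ (inj₂ (inj₁ (_ , wi≡wj)))) =
      <-irrefl (w j) (subst (w j <_) wi≡wj (<-≤-trans (1<x⇒y<x*y 0<wj 1<a) a*wj≤wi))
    1<entry⇒¬OrderReversal 0<wj 1<a a*wj≤wi (inj₂ (inj₂ (inj₂ (a≡1 , _)))) = <⇒≢ 1<a (sym a≡1)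

    ¬OrderReversal⇒≤ : ¬ (1# < A i j) → ¬ OrderReversal A w i j → w i ≤ w j
    ¬OrderReversal⇒≤ a≯1 ¬rev with ≤⊎> (w i) (w j)
    ... | inj₁ wi≤wj = wi≤wj
    ... | inj₂ wj<wi with <-trichotomy (A i j) 1#
    ...   | inj₁ a<1        = contradiction (inj₁ (a<1 , wj<wi)) ¬rev
    ...   | inj₂ (inj₁ a≡1) = contradiction (inj₂ (inj₂ (inj₂ (a≡1 , <⇒≢ wj<wi ∘ sym)))) ¬rev
    ...   | inj₂ (inj₂ 1<a) = contradiction 1<a a≯1

    ¬OrderReversal⇒entry≡1 : w i ≡ w j → ¬ OrderReversal A w i j → A i j ≡ 1#
    ¬OrderReversal⇒entry≡1 wi≡wj ¬rev = ≮∧≯⇒≡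
      (λ a<1 → ¬rev (inj₂ (inj₂ (inj₁ (<⇒≢ a<1 , wi≡wj)))))
      (λ 1<a → ¬rev (inj₂ (inj₂ (inj₁ (<⇒≢ 1<a ∘ sym , wi≡wj)))))

    entry<1⇒OrderReversal⇔≥ : A i j < 1# → OrderReversal A w i j ⇔ w j ≤ w i
    entry<1⇒OrderReversal⇔≥ a<1 = mk⇔ to from
      where
      to : OrderReversal A w i j → w j ≤ w i
      to (inj₁ (_ , wj<wi))                  = inj₁ wj<wi
      to (inj₂ (inj₁ (1<a , _)))             = contradiction 1<a (<-asym a<1)
      to (inj₂ (inj₂ (inj₁ (_ , wi≡wj))))    = inj₂ (sym wi≡wj)
      to (inj₂ (inj₂ (inj₂ (a≡1 , _))))      = contradiction a≡1 (<⇒≢ a<1)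

      from : w j ≤ w i → OrderReversal A w i j
      from (inj₁ wj<wi) = inj₁ (a<1 , wj<wi)
      from (inj₂ wj≡wi) = inj₂ (inj₂ (inj₁ (<⇒≢ a<1 , sym wj≡wi)))

  module AlongCycle {n} (A : Matrix (suc n)) (C : HamiltonianCycle (suc n)) (A-pos : ∀ i j → 0# < A i j) where
    private
      γ : Fin (suc n) → Fin (suc n)
      γ = proj₁ C

      c : Fin (suc n) → ℝ
      c = entryAlong A C

      P : ℝ
      P = cycleProduct A C

      γ-surjective : ∀ j → ∃ λ k → γ k ≡ j
      γ-surjective = injective⇒surjective (λ {i} {j} → proj₂ C i j)

      γ⁻¹ : Fin (suc n) → Fin (suc n)
      γ⁻¹ j = proj₁ (γ-surjective j)

    Reversal : (Fin (suc n) → ℝ) → Fin (suc n) → Set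
    Reversal w k = OrderReversal A w (γ k) (γ (next k))

    NoReversalCondition : Set
    NoReversalCondition = (Σ (Fin (suc n)) λ k → 1# < c k) ⊎ P ≡ 1#

    ¬Reversal⇒cycleProduct≡1 : ∀ w → (∀ k → ¬ (1# < c k)) → (∀ k → ¬ Reversal w k) → P ≡ 1#
    ¬Reversal⇒cycleProduct≡1 w c≯1 ¬rev = prodFin-≡1 c c≡1
      where
      constant : ∀ k → w (γ k) ≡ w (γ fzero)
      constant = cyclic-ascending⇒constant (w ∘ γ) (λ k → ¬OrderReversal⇒≤ A w (c≯1 k) (¬rev k))

      c≡1 : ∀ k → c k ≡ 1#
      c≡1 k = ¬OrderReversal⇒entry≡1 A w (trans (constant k) (sym (constant (next k)))) (¬rev k)

    module Cut (m : Fin (suc n)) where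
      open CutWeights c (λ k → A-pos _ _) m

      w : Fin (suc n) → ℝ
      w = weights ∘ γ⁻¹

      w∘γ : ∀ k → w (γ k) ≡ weights k
      w∘γ k = cong weights (proj₂ C _ _ (proj₂ (γ-surjective (γ k))))

      w-pos : ∀ j → 0# < w j
      w-pos = weights-pos ∘ γ⁻¹

      w-exact : ∀ k → k ≢ m → w (γ k) ≡ c k * w (γ (next k))
      w-exact k k≢m = trans (w∘γ k) (trans (weights-exact k k≢m) (cong (c k *_) (sym (w∘γ (next k)))))

      w-cut : c m * w (γ (next m)) ≡ P * w (γ m)
      w-cut = trans (cong (c m *_) (w∘γ (next m))) (trans weights-cut (cong (P *_) (sym (w∘γ m))))

      w∈ε : P ≤ 1# → InEpsilon A C w
      w∈ε P≤1 = w-pos , edge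
        where
        edge : ∀ k → c k * w (γ (next k)) ≤ w (γ k)
        edge k with k ≟ m
        ... | yes refl = subst₂ _≤_ (sym w-cut) (*-identityˡ (w (γ m))) (*-monoˡ-≤ (w-pos (γ m)) P≤1)
        ... | no k≢m   = inj₂ (sym (w-exact k k≢m))

      ¬Reversal-off-cut : ∀ k → k ≢ m → ¬ Reversal w k
      ¬Reversal-off-cut k k≢m = tight⇒¬OrderReversal A w (w-pos _) (w-exact k k≢m)

      ¬Reversal-everywhere : ¬ Reversal w m → ∀ k → ¬ Reversal w k
      ¬Reversal-everywhere ¬rev-m k with k ≟ m
      ... | yes refl = ¬rev-m
      ... | no k≢m   = ¬Reversal-off-cut k k≢m

    reversalFree⇔ : P ≤ 1# →
      (Σ (Fin (suc n) → ℝ) λ w → InEpsilon A C w × (∀ k → ¬ Reversal w k)) ⇔ NoReversalCondition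
    reversalFree⇔ P≤1 = mk⇔ to from
      where
      to : (Σ (Fin (suc n) → ℝ) λ w → InEpsilon A C w × (∀ k → ¬ Reversal w k)) → NoReversalCondition
      to (w , _ , ¬rev) with any? (λ k → 1# <? c k)
      ... | yes c>1 = inj₁ c>1
      ... | no  c≯1 = inj₂ (¬Reversal⇒cycleProduct≡1 w (λ k 1<c → c≯1 (k , 1<c)) ¬rev)

      from : NoReversalCondition → Σ (Fin (suc n) → ℝ) λ w → InEpsilon A C w × (∀ k → ¬ Reversal w k)
      from (inj₁ (m , 1<cm)) = w , w∈ε P≤1 ,
        ¬Reversal-everywhere (1<entry⇒¬OrderReversal A w (w-pos _) 1<cm (proj₂ (w∈ε P≤1) m))
        where open Cut m
      from (inj₂ P≡1) = w , w∈ε P≤1 , ¬Reversal-everywhere (tight⇒¬OrderReversal A w (w-pos _) tight)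
        where
        open Cut fzero
        tight : w (γ fzero) ≡ c fzero * w (γ (next fzero))
        tight = sym (trans w-cut (trans (cong (_* w (γ fzero)) P≡1) (*-identityˡ _)))

    singleReversal : P ≤ 1# → ¬ NoReversalCondition →
      Σ (Fin (suc n) → ℝ) λ w → InEpsilon A C w ×
        (Σ (Fin (suc n)) λ k → Reversal w k × (∀ k′ → Reversal w k′ → k′ ≡ k))
    singleReversal P≤1 ¬cond with any? (λ k → c k <? 1#)
    ... | no c≮1 = contradiction (inj₂ (prodFin-≡1 c c≡1)) ¬cond
      where
      c≡1 : ∀ k → c k ≡ 1#
      c≡1 k = ≮∧≯⇒≡ (λ ck<1 → c≮1 (k , ck<1)) (λ 1<ck → ¬cond (inj₁ (k , 1<ck)))
    ... | yes (m , cm<1) = w , w∈ε P≤1 , m , reversal-at-cut , unique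
      where
      open Cut m
      open Equivalence (entry<1⇒OrderReversal⇔≥ A w cm<1)

      reversal-at-cut : Reversal w m
      reversal-at-cut with ≤⊎> (w (γ (next m))) (w (γ m))
      ... | inj₁ descends = from descends
      ... | inj₂ ascends  = contradiction (Equivalence.to (reversalFree⇔ P≤1) reversalFree) ¬cond
        where
        reversalFree : Σ (Fin (suc n) → ℝ) λ w → InEpsilon A C w × (∀ k → ¬ Reversal w k)
        reversalFree = w , w∈ε P≤1 , ¬Reversal-everywhere (<⇒≱ ascends ∘ to)

      unique : ∀ k′ → Reversal w k′ → k′ ≡ m
      unique k′ rev with k′ ≟ m
      ... | yes k′≡m = k′≡m
      ... | no  k′≢m = contradiction rev (¬Reversal-off-cut k′ k′≢m)

theorem13 : (R : RealField) → let open RealField R in let open Matrices R in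
    (n : ℕ) .{{_ : NonZero n}} (A : Matrix n) (C : HamiltonianCycle n) →
    Reciprocal A → ¬ Consistent A → cycleProduct A C ≤ 1# →
    ((Σ (Fin n → ℝ) λ w → InEpsilon A C w ×
        (∀ k → ¬ OrderReversal A w (proj₁ C k) (proj₁ C (next k))))
      ⇔ ((Σ (Fin n) λ k → 1# < entryAlong A C k) ⊎ cycleProduct A C ≡ 1#))
    × (¬ ((Σ (Fin n) λ k → 1# < entryAlong A C k) ⊎ cycleProduct A C ≡ 1#) →
       Σ (Fin n → ℝ) λ w → InEpsilon A C w ×
         (Σ (Fin n) λ k → OrderReversal A w (proj₁ C k) (proj₁ C (next k)) ×
           (∀ k′ → OrderReversal A w (proj₁ C k′) (proj₁ C (next k′)) → k′ ≡ k)))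
-- The empty matrix is consistent; this is the only use of inconsistency.
theorem13 R zero    A C _           inconsistent _   = contradiction ((λ ()) , (λ ()) , (λ ())) inconsistent
theorem13 R (suc n) A C (A-pos , _) _            P≤1 = reversalFree⇔ P≤1 , singleReversal P≤1
  where open AlongCycle R A C A-pos
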